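{- For every $G\subseteq A$ and every $\varphi\in\mathcal{L}_{CoGAL}$, the formula $\langle\![G]\!\rangle\varphi\to\langle G\rangle[A\setminus G]\varphi$ is valid.
   Context: Fix a finite set of agents $A$ and a countable set $P$ of propositional variables. The language $\mathcal{L}_{CoGAL}$ is given by $\varphi ::= p \mid \neg\varphi \mid (\varphi\wedge\varphi) \mid K_a\varphi \mid [\varphi]\varphi \mid [G]\varphi \mid [\!\langle G\rangle\!]\varphi$ with $p\in P$, $a\in A$, $G\subseteq A$; usual propositional abbreviations; duals $\langle\varphi\rangle\psi=\neg[\varphi]\neg\psi$, $\langle G\rangle\varphi=\neg[G]\neg\varphi$, $\langle\![G]\!\rangle\varphi=\neg[\!\langle G\rangle\!]\neg\varphi$. $\mathcal{L}_{EL}$ is the fragment built from $p,\neg,\wedge,K_a$ only. For $G\subseteq A$, $\mathcal{L}_{EL}^G$ is the set of formulas $\bigwedge_{i\in G}K_i\varphi_i$ with each $\varphi_i\in\mathcal{L}_{EL}$. An epistemic model is $M=(W,\sim,V)$ with $W\neq\emptyset$, $\sim_a$ an equivalence relation on $W$ for each $a\in A$, $V:P\to\mathcal P(W)$. Semantics at $(M,w)$: $p$ iff $w\in V(p)$; Boolean clauses as usual; $K_a\varphi$ iff $(M,v)\models\varphi$ for all $v$ with $w\sim_a v$; $[\varphi]\psi$ iff $(M,w)\models\varphi$ implies $(M^\varphi,w)\models\psi$, where $M^\varphi$ is the restriction of $M$ to $\llbracket\varphi\rrbracket_M=\{v:(M,v)\models\varphi\}$; $[G]\varphi$ iff for all $\psi\in\mathcal{L}_{EL}^G$,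 $(M,w)\models[\psi]\varphi$; $[\!\langle G\rangle\!]\varphi$ iff for all $\psi\in\mathcal{L}_{EL}^G$ there is $\chi\in\mathcal{L}_{EL}^{A\setminus G}$ with $(M,w)\models\psi\to\langle\psi\wedge\chi\rangle\varphi$. Consequently $(M,w)\models\langle\![G]\!\rangle\varphi$ iff there is $\psi\in\mathcal{L}_{EL}^G$ such that for all $\chi\in\mathcal{L}_{EL}^{A\setminus G}$, $(M,w)\models\psi\wedge[\psi\wedge\chi]\varphi$. A formula is valid if true at every pointed model. -}

module Defs where

open import Level using (0ℓ)
open import Data.Nat using (ℕ)
open import Data.Fin using (Fin)
open import Data.Fin.Subset using (Subset; _∈_; ∁)
open import Data.Product using (Σ; _×_; _,_; proj₁; proj₂; ∃)
open import Relation.Nullary using (¬_)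
open import Relation.Binary.Structures using (IsEquivalence)

-- Agents: A = Fin n (a finite set).  Coalitions G ⊆ A: Subset n.
-- Propositional variables: P = ℕ (countable).
Prop : Set
Prop = ℕ

data EL (n : ℕ) : Set where
  atom : Prop → EL n
  neg  : EL n → EL n
  conj : EL n → EL n → EL n
  K    : Fin n → EL n → EL n

data Form (n : ℕ) : Set where
  atom    : Prop → Form n
  neg     : Form n → Form n
  conj    : Form n → Form n → Form n
  K       : Fin n → Form n → Form n
  ann     : Form n → Form n → Form n
  grp     : Subset n → Form n → Form n
  coal    : Subset n → Form n → Form n

_⇒_ : ∀ {n} → Form n → Form n → Form n
φ ⇒ ψ = neg (conj φ (neg ψ))

annDia : ∀ {n} → Form n → Form n → Form n
annDia φ ψ = neg (ann φ (neg ψ))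

grpDia : ∀ {n} → Subset n → Form n → Form n
grpDia G φ = neg (grp G (neg φ))

coalDia : ∀ {n} → Subset n → Form n → Form n
coalDia G φ = neg (coal G (neg φ))

record Model (n : ℕ) : Set₁ where
  field
    W     : Set
    R     : Fin n → W → W → Set
    R-eq  : (a : Fin n) → IsEquivalence (R a)
    V     : Prop → W → Set
open Model public

restrict : ∀ {n} (M : Model n) → (W M → Set) → Model n
restrict M S = record
  { W    = Σ (W M) S
  ; R    = λ a u v → R M a (proj₁ u) (proj₁ v)
  ; R-eq = λ a → record
      { refl  = IsEquivalence.refl (R-eq M a)
      ; sym   = IsEquivalence.sym (R-eq M a)
      ; trans = IsEquivalence.trans (R-eq M a) }
  ; V    = λ p u → V M p (proj₁ u)
  }

satEL : ∀ {n} (M : Model n) → EL n → W M → Set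
satEL M (atom p)   w = V M p w
satEL M (neg φ)    w = ¬ satEL M φ w
satEL M (conj φ ψ) w = satEL M φ w × satEL M ψ w
satEL M (K a φ)    w = ∀ v → R M a w v → satEL M φ v

-- A formula of L_EL^G, ⋀_{i∈G} K_i φ_i, is given by the family (φ_i);
-- entries outside G are irrelevant.  Its truth (as the conjunction;
-- the empty conjunction being ⊤):
GroupAnn : ℕ → Set
GroupAnn n = Fin n → EL n

satGA : ∀ {n} (M : Model n) → Subset n → GroupAnn n → W M → Set
satGA M G ψ w = ∀ i → i ∈ G → satEL M (K i (ψ i)) w

sat : ∀ {n} (M : Model n) → Form n → W M → Set
sat M (atom p)   w = V M p w
sat M (neg φ)    w = ¬ sat M φ w
sat M (conj φ ψ) w = sat M φ w × sat M ψ w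
sat M (K a φ)    w = ∀ v → R M a w v → sat M φ v
sat M (ann φ ψ)  w =
  (h : sat M φ w) → sat (restrict M (sat M φ)) ψ (w , h)
sat {n} M (grp G φ)  w =
  (ψ : GroupAnn n) (h : satGA M G ψ w) →
    sat (restrict M (satGA M G ψ)) φ (w , h)
sat {n} M (coal G φ) w =
  (ψ : GroupAnn n) → ∃ λ (χ : GroupAnn n) →
    satGA M G ψ w →
      Σ (satGA M G ψ w × satGA M (∁ G) χ w) λ h →
        sat (restrict M (λ v → satGA M G ψ v × satGA M (∁ G) χ v)) φ (w , h)

Valid : ∀ {n} → Form n → Set₁
Valid {n} φ = (M : Model n) (w : W M) → sat M φ w

-- Contrapositively, assume [G]⟨A∖G⟩¬φ at w and show [⟨G⟩]¬φ there. Given an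
-- announcement ψ of G that is true at w, the submodel M^ψ has an announcement
-- χ′ of A∖G after which ¬φ holds. Rewriting each [ψ]χ′ᵢ into epistemic logic
-- by the reduction axioms of public announcement logic yields an announcement
-- χ of A∖G in M itself with M^(ψ∧χ) isomorphic to (M^ψ)^χ′, and CoGAL truth is
-- invariant under bisimulation, so ¬φ also holds after ψ ∧ χ.
module Submission where

open import Defs
open import Level using (0ℓ)
open import Data.Nat using (ℕ)
open import Data.Fin using (Fin; zero; suc)
open import Data.Fin.Subset using (Subset; _∈_; ∁)
open import Data.Bool using (true; false)
open import Data.Vec using ([]; _∷_)
open import Data.Vec.Base using (here; there)
open import Data.Product using (Σ; _×_; _,_; proj₁; proj₂)
open import Data.Product.Function.NonDependent.Propositional using (_×-⇔_)
open import Data.Empty using (⊥-elim)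
open import Function using (_∘_; flip)
open import Function.Bundles using (_⇔_; mk⇔; Equivalence)
open import Function.Construct.Identity using (⇔-id)
open import Function.Construct.Symmetry using (⇔-sym)
open import Relation.Nullary using (¬_; yes; no)
open import Relation.Binary.PropositionalEquality using (_≡_; refl)
open import Axiom.ExcludedMiddle using (ExcludedMiddle)
open import Axiom.DoubleNegationElimination using (em⇒dne)

open Equivalence using (to; from)

record IsBisimulation {n : ℕ} (M N : Model n) (Z : W M → W N → Set) : Set where
  field
    atoms : ∀ {x y} → Z x y → ∀ p → V M p x ⇔ V N p y
    forth : ∀ {x y} a x′ → Z x y → R M a x x′ → Σ (W N) λ y′ → R N a y y′ × Z x′ y′
    back  : ∀ {x y} a y′ → Z x y → R N a y y′ → Σ (W M) λ x′ → R M a x x′ × Z x′ y′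
open IsBisimulation

module _ {n : ℕ} where

  isBisimulation-flip : ∀ {M N : Model n} {Z} → IsBisimulation M N Z → IsBisimulation N M (flip Z)
  atoms (isBisimulation-flip B) z p = ⇔-sym (atoms B z p)
  forth (isBisimulation-flip B) = back B
  back  (isBisimulation-flip B) = forth B

  ≡-isBisimulation : ∀ {M : Model n} → IsBisimulation M M _≡_
  atoms ≡-isBisimulation refl p = ⇔-id _
  forth ≡-isBisimulation a x′ refl r = x′ , r , refl
  back  ≡-isBisimulation a y′ refl r = y′ , r , refl

  restrict-isBisimulation : ∀ {M N : Model n} {Z} → IsBisimulation M N Z →
    (S : W M → Set) (T : W N → Set) → (∀ {x y} → Z x y → S x ⇔ T y) →
    IsBisimulation (restrict M S) (restrict N T) (λ u v → Z (proj₁ u) (proj₁ v))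
  atoms (restrict-isBisimulation B S T S⇔T) z = atoms B z
  forth (restrict-isBisimulation B S T S⇔T) a (x′ , hx′) z r =
    let (y′ , r′ , z′) = forth B a x′ z r in (y′ , to (S⇔T z′) hx′) , r′ , z′
  back  (restrict-isBisimulation B S T S⇔T) a (y′ , hy′) z r =
    let (x′ , r′ , z′) = back B a y′ z r in (x′ , from (S⇔T z′) hy′) , r′ , z′

  restrict-restrict-isBisimulation : (M : Model n) (S T : W M → Set)
    (T′ : W (restrict M S) → Set) → (∀ v h → T v ⇔ T′ (v , h)) →
    IsBisimulation (restrict M (λ v → S v × T v)) (restrict (restrict M S) T′)
                   (λ u v → proj₁ u ≡ proj₁ (proj₁ v))
  atoms (restrict-restrict-isBisimulation M S T T′ T⇔T′) refl p = ⇔-id _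
  forth (restrict-restrict-isBisimulation M S T T′ T⇔T′) a (x′ , hS , hT) refl r =
    ((x′ , hS) , to (T⇔T′ x′ hS) hT) , r , refl
  back  (restrict-restrict-isBisimulation M S T T′ T⇔T′) a ((y′ , hS) , hT′) refl r =
    (y′ , hS , from (T⇔T′ y′ hS) hT′) , r , refl

  satEL-preserved : ∀ {M N : Model n} {Z} → IsBisimulation M N Z →
    ∀ χ {x y} → Z x y → satEL M χ x → satEL N χ y
  satEL-preserved B (atom p)   z = to (atoms B z p)
  satEL-preserved B (neg χ)    z ¬sχ sχ = ¬sχ (satEL-preserved (isBisimulation-flip B) χ z sχ)
  satEL-preserved B (conj χ ξ) z (sχ , sξ) = satEL-preserved B χ z sχ , satEL-preserved B ξ z sξ
  satEL-preserved B (K a χ)    z k y′ r =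
    let (x′ , r′ , z′) = back B a y′ z r in satEL-preserved B χ z′ (k x′ r′)

  satGA-invariant : ∀ {M N : Model n} {Z} → IsBisimulation M N Z →
    ∀ G ψ {x y} → Z x y → satGA M G ψ x ⇔ satGA N G ψ y
  satGA-invariant B G ψ z = mk⇔
    (λ g i i∈G → satEL-preserved B (K i (ψ i)) z (g i i∈G))
    (λ g i i∈G → satEL-preserved (isBisimulation-flip B) (K i (ψ i)) z (g i i∈G))

  sat-preserved : ∀ {M N : Model n} {Z} → IsBisimulation M N Z →
    ∀ φ {x y} → Z x y → sat M φ x → sat N φ y
  sat-invariant : ∀ {M N : Model n} {Z} → IsBisimulation M N Z →
    ∀ φ {x y} → Z x y → sat M φ x ⇔ sat N φ y

  sat-preserved B (atom p)   z = to (atoms B z p)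
  sat-preserved B (neg φ)    z ¬sφ sφ = ¬sφ (sat-preserved (isBisimulation-flip B) φ z sφ)
  sat-preserved B (conj φ ψ) z (sφ , sψ) = sat-preserved B φ z sφ , sat-preserved B ψ z sψ
  sat-preserved B (K a φ)    z k y′ r =
    let (x′ , r′ , z′) = back B a y′ z r in sat-preserved B φ z′ (k x′ r′)
  sat-preserved {M} {N} B (ann φ ψ) z f hN =
    sat-preserved (restrict-isBisimulation B (sat M φ) (sat N φ) (sat-invariant B φ)) ψ z
      (f (from (sat-invariant B φ z) hN))
  sat-preserved B (grp G φ) z f ψ hN =
    sat-preserved (restrict-isBisimulation B _ _ (satGA-invariant B G ψ)) φ z
      (f ψ (from (satGA-invariant B G ψ z) hN))
  sat-preserved {M} {N} {Z} B (coal G φ) z f ψ =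
    let (χ , g) = f ψ in χ , λ hN →
      let (hM , sφ) = g (from (satGA-invariant B G ψ z) hN) in
      to (announced χ z) hM , sat-preserved (restrict-isBisimulation B _ _ (announced χ)) φ z sφ
    where
    announced : ∀ χ {x y} → Z x y →
      (satGA M G ψ x × satGA M (∁ G) χ x) ⇔ (satGA N G ψ y × satGA N (∁ G) χ y)
    announced χ z′ = satGA-invariant B G ψ z′ ×-⇔ satGA-invariant B (∁ G) χ z′

  sat-invariant B φ z = mk⇔ (sat-preserved B φ z) (sat-preserved (isBisimulation-flip B) φ z)

⊤EL : ∀ {m} → EL m
⊤EL = neg (conj (atom 0) (neg (atom 0)))

⋀[_]_ : ∀ {k m} → Subset k → (Fin k → EL m) → EL m
⋀[ [] ]         f = ⊤EL
⋀[ true ∷ G ]  f = conj (f zero) (⋀[ G ] (f ∘ suc))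
⋀[ false ∷ G ] f = ⋀[ G ] (f ∘ suc)

satEL-⋀ : ∀ {k m} (M : Model m) (G : Subset k) f v →
  satEL M (⋀[ G ] f) v ⇔ (∀ i → i ∈ G → satEL M (f i) v)
satEL-⋀ M G f v = mk⇔ (sound G f) (complete G f)
  where
  sound : ∀ {k} (G : Subset k) f → satEL M (⋀[ G ] f) v → ∀ i → i ∈ G → satEL M (f i) v
  sound (true ∷ G)  f (sf₀ , sG) zero    here       = sf₀
  sound (true ∷ G)  f (sf₀ , sG) (suc i) (there i∈G) = sound G (f ∘ suc) sG i i∈G
  sound (false ∷ G) f sG         (suc i) (there i∈G) = sound G (f ∘ suc) sG i i∈G

  complete : ∀ {k} (G : Subset k) f → (∀ i → i ∈ G → satEL M (f i) v) → satEL M (⋀[ G ] f) v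
  complete []          f sf (p , ¬p) = ¬p p
  complete (true ∷ G)  f sf = sf zero here , complete G (f ∘ suc) (λ i → sf (suc i) ∘ there)
  complete (false ∷ G) f sf = complete G (f ∘ suc) (λ i → sf (suc i) ∘ there)

announcement : ∀ {n} → Subset n → GroupAnn n → EL n
announcement G ψ = ⋀[ G ] (λ i → K i (ψ i))

satEL-announcement : ∀ {n} (M : Model n) G ψ v → satEL M (announcement G ψ) v ⇔ satGA M G ψ v
satEL-announcement M G ψ = satEL-⋀ M G (λ i → K i (ψ i))

satEL-restrict-irrelevant : ∀ {n} {M : Model n} (S : W M → Set) χ {v} {h h′ : S v} →
  satEL (restrict M S) χ (v , h) → satEL (restrict M S) χ (v , h′)
satEL-restrict-irrelevant S χ =
  satEL-preserved (restrict-isBisimulation ≡-isBisimulation S S (λ { refl → ⇔-id _ })) χ refl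

module Relativization {n : ℕ} (lem : ExcludedMiddle 0ℓ) (M : Model n)
  (S : W M → Set) (s : EL n) (s⇔S : ∀ v → satEL M s v ⇔ S v) where

  -- The reduction axioms of public announcement logic, read as a definition of [s]χ.
  relativize : EL n → EL n
  relativize (atom p)   = neg (conj s (neg (atom p)))
  relativize (neg χ)    = neg (conj s (relativize χ))
  relativize (conj χ ξ) = conj (relativize χ) (relativize ξ)
  relativize (K a χ)    = neg (conj s (neg (K a (relativize χ))))

  relativize-sound : ∀ χ v → satEL M (relativize χ) v →
    (h : S v) → satEL (restrict M S) χ (v , h)
  relativize-complete : ∀ χ v →
    ((h : S v) → satEL (restrict M S) χ (v , h)) → satEL M (relativize χ) v

  relativize-sound (atom p) v t h = em⇒dne lem λ ¬p → t (from (s⇔S v) h , ¬p)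
  relativize-sound (neg χ) v t h sχ =
    t (from (s⇔S v) h , relativize-complete χ v (λ _ → satEL-restrict-irrelevant S χ sχ))
  relativize-sound (conj χ ξ) v (tχ , tξ) h = relativize-sound χ v tχ h , relativize-sound ξ v tξ h
  relativize-sound (K a χ) v t h (u , hu) r =
    relativize-sound χ u (em⇒dne lem (λ ¬k → t (from (s⇔S v) h , ¬k)) u r) hu

  relativize-complete (atom p) v f (sv , ¬p) = ¬p (f (to (s⇔S v) sv))
  relativize-complete (neg χ) v f (sv , tχ) =
    f (to (s⇔S v) sv) (relativize-sound χ v tχ (to (s⇔S v) sv))
  relativize-complete (conj χ ξ) v f =
    relativize-complete χ v (proj₁ ∘ f) , relativize-complete ξ v (proj₂ ∘ f)
  relativize-complete (K a χ) v f (sv , ¬k) =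
    ¬k (λ u r → relativize-complete χ u (λ hu → f (to (s⇔S v) sv) (u , hu) r))

  satGA-restrict : ∀ H χ v (h : S v) →
    satGA M H (relativize ∘ χ) v ⇔ satGA (restrict M S) H χ (v , h)
  satGA-restrict H χ v h = mk⇔
    (λ t i i∈H (u , hu) r → relativize-sound (χ i) u (t i i∈H u r) hu)
    (λ t i i∈H u r → relativize-complete (χ i) u (λ hu → t i i∈H (u , hu) r))

coal-¬-from-grp-¬grp : ExcludedMiddle 0ℓ → ∀ {n} (M : Model n) (G : Subset n) φ w →
  sat M (grp G (neg (grp (∁ G) φ))) w → sat M (coal G (neg φ)) w
coal-¬-from-grp-¬grp lem {n} M G φ w after-ψ ψ with lem {satGA M G ψ w}
... | no ¬hψ = ψ , λ hψ → ⊥-elim (¬hψ hψ)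
... | yes hψ =
  let (χ , hχ , ¬sφ) = counterexample
      composition = restrict-restrict-isBisimulation M (satGA M G ψ)
                      (satGA M (∁ G) (relativize ∘ χ)) (satGA Mψ (∁ G) χ) (satGA-restrict (∁ G) χ)
  in relativize ∘ χ , λ _ →
     (hψ , from (satGA-restrict (∁ G) χ w hψ) hχ) ,
     λ sφ → ¬sφ (sat-preserved composition φ refl sφ)
  where
  open Relativization lem M (satGA M G ψ) (announcement G ψ) (satEL-announcement M G ψ)

  Mψ : Model n
  Mψ = restrict M (satGA M G ψ)

  counterexample : Σ (GroupAnn n) λ χ → Σ (satGA Mψ (∁ G) χ (w , hψ)) λ hχ →
                     ¬ sat (restrict Mψ (satGA Mψ (∁ G) χ)) φ ((w , hψ) , hχ)
  counterexample = em⇒dne lem λ ∄ →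
    after-ψ ψ hψ λ χ hχ → em⇒dne lem λ ¬sφ → ∄ (χ , hχ , ¬sφ)

proposition2 : ExcludedMiddle 0ℓ →
    (n : ℕ) (G : Subset n) (φ : Form n) →
    Valid (coalDia G φ ⇒ grpDia G (grp (∁ G) φ))
proposition2 lem n G φ M w (¬coal , ¬¬grp) =
  ¬¬grp λ grp-¬grp → ¬coal (coal-¬-from-grp-¬grp lem M G φ w grp-¬grp)
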